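{- Let $G$ be a simple graph of order $n\ge2$ and $t\ge 2$. If $C$ is a clique of $S[G,t]$ with at least $4$ vertices, then there is a word $w\in V^{t-1}$ such that $C$ is contained in the vertex set of the copy $G_w$ of $G$ in $S[G,t]$.
   Context: Let $G$ be a simple graph with vertex set $V=\{1,\dots,n\}$, $n\ge 2$. For $t\ge 1$, the generalized Sierpiński graph $S(G,t)$ has vertex set $V^t$ (words $u_1u_2\cdots u_t$ over $V$), and two words ${\bf u}=u_1\cdots u_t$, ${\bf v}=v_1\cdots v_t$ are adjacent iff there is $i\in\{1,\dots,t\}$ with $u_j=v_j$ for $j<i$, $u_i\neq v_i$ and $u_iv_i\in E(G)$, and $u_j=v_i$, $v_j=u_i$ for all $j>i$. An edge of this kind with $i<t$ is called a linking edge. The generalized Sierpiński gasket $S[G,t]$ is the graph obtained from $S(G,t)$ by contracting all linking edges. For a word $w\in V^{t-1}$, the words $wv$ ($v\in V$) induce in $S(G,t)$ a subgraph isomorphic to $G$; the copy $G_w$ of $G$ in $S[G,t]$ is the subgraph of $S[G,t]$ induced by the images of the words $wv$, $v\in V$, under the contraction (it is isomorphic to $G$). -}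

module Defs where

open import Data.Nat using (ℕ; suc; _≤_) renaming (_<_ to _<ℕ_)
open import Data.Fin using (Fin; toℕ; _<_)
open import Data.Vec using (Vec; lookup)
open import Data.List using (List; length)
import Data.List as L
open import Data.Product using (_×_; ∃)
open import Relation.Nullary using (¬_)
open import Relation.Binary.PropositionalEquality using (_≡_; _≢_)
open import Relation.Binary.Construct.Closure.Equivalence using (EqClosure)

record SimpleGraph (n : ℕ) : Set₁ where
  field
    Adj    : Fin n → Fin n → Set
    sym    : ∀ {a b} → Adj a b → Adj b a
    irrefl : ∀ {a} → ¬ Adj a a
open SimpleGraph public

Word : ℕ → ℕ → Set
Word n t = Vec (Fin n) t

module _ {n : ℕ} (G : SimpleGraph n) {t : ℕ} where

  EdgeAt : Fin t → Word n t → Word n t → Set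
  EdgeAt i u v =
    (∀ j → j < i → lookup u j ≡ lookup v j) ×
    (lookup u i ≢ lookup v i) ×
    Adj G (lookup u i) (lookup v i) ×
    (∀ j → i < j → (lookup u j ≡ lookup v i) × (lookup v j ≡ lookup u i))

  SAdj : Word n t → Word n t → Set
  SAdj u v = ∃ λ i → EdgeAt i u v

  -- linking edge: i < t (1-based), i.e. not the last position
  Linking : Word n t → Word n t → Set
  Linking u v = ∃ λ (i : Fin t) → (suc (toℕ i) <ℕ t) × EdgeAt i u v

  -- two words are identified in S[G,t] iff equivalent under the
  -- equivalence closure of the linking edges (contraction)
  _≈S_ : Word n t → Word n t → Set
  u ≈S v = EqClosure Linking u v

  GAdj : Word n t → Word n t → Set
  GAdj u v = ¬ (u ≈S v) × ∃ λ u' → ∃ λ v' → (u ≈S u') × (v ≈S v') × SAdj u' v'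

  -- a clique of S[G,t], given by a list of representative words:
  -- any two entries at distinct positions are adjacent (hence distinct vertices)
  IsClique : List (Word n t) → Set
  IsClique C = ∀ (i j : Fin (length C)) → i ≢ j → GAdj (L.lookup C i) (L.lookup C j)

-- Contracting a linking edge identifies exactly its two ends, and the linking
-- edges of S(G,t) form a matching. Hence a vertex of S[G,t] lies in at most two
-- copies G_w, every edge lies in some copy, and two adjacent vertices never share
-- two copies, since at most one linking edge joins two given copies. If the edges
-- of a triangle of the clique lay in three different copies, a fourth clique
-- vertex would have to share two of them with a triangle vertex; so the triangle
-- lies in one copy, and every common neighbour of it is forced into that copy.
{-# OPTIONS --safe #-}
module Submission where

open import Defs
open import Data.Nat using (ℕ; suc; _≤_)
open import Data.Fin using (Fin)
open import Data.Vec using (Vec; _∷ʳ_)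
open import Data.List using (List; length)
open import Data.List.Relation.Unary.All using (All)
open import Data.Product using (∃)

open import Data.Nat using (zero; z≤n; s≤s; s≤s⁻¹) renaming (_<_ to _<ℕ_)
import Data.Nat.Properties as ℕ
import Data.Fin as Fin
open import Data.Fin using (toℕ; fromℕ<; _<_; _↑ʳ_)
open import Data.Fin.Patterns using (0F; 1F; 2F)
open import Data.Fin.Properties using (toℕ-fromℕ<; <-cmp; <-trans)
open import Data.Vec using ([]; _∷_; lookup; init; last; initLast)
open import Data.Vec.Properties using (∷-injective; ∷ʳ-injectiveˡ; init-∷ʳ)
import Data.Vec.Properties as Vec
open import Data.Vec.Relation.Binary.Pointwise.Extensional using (ext; Pointwise-≡⇒≡)
open import Data.List using (_∷_)
import Data.List as List
open import Data.List.Properties using (tabulate-lookup)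
open import Data.List.Relation.Unary.All using (_∷_)
open import Data.List.Relation.Unary.All.Properties using (tabulate⁺)
open import Data.Product using (_×_; _,_; proj₁; proj₂)
open import Data.Sum using (_⊎_; inj₁; inj₂)
open import Data.Empty using (⊥; ⊥-elim)
open import Relation.Nullary using (¬_; yes; no)
open import Relation.Binary using (Rel; IsEquivalence; DecidableEquality)
open import Relation.Binary.Definitions using (tri<; tri≈; tri>)
open import Relation.Binary.PropositionalEquality as ≡
  using (_≡_; _≢_; refl; trans; cong₂; subst; ≢-sym; module ≡-Reasoning)
open import Relation.Binary.Construct.Closure.ReflexiveTransitive using (_◅◅_)
import Relation.Binary.Construct.Closure.Equivalence as EqClosure

module _ {A : Set} where

  lookup-ext : ∀ {m} {xs ys : Vec A m} → (∀ k → lookup xs k ≡ lookup ys k) → xs ≡ ys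
  lookup-ext eq = Pointwise-≡⇒≡ (ext eq)

  init-≡⇒lookup-≡ : ∀ {m} {xs ys : Vec A (suc m)} → init xs ≡ init ys →
                    ∀ k → suc (toℕ k) <ℕ suc m → lookup xs k ≡ lookup ys k
  init-≡⇒lookup-≡ {zero}  _  0F (s≤s ())
  init-≡⇒lookup-≡ {suc m} {_ ∷ _} {_ ∷ _} eq 0F          _       = proj₁ (∷-injective eq)
  init-≡⇒lookup-≡ {suc m} {_ ∷ _} {_ ∷ _} eq (Fin.suc k) (s≤s h) =
    init-≡⇒lookup-≡ (proj₂ (∷-injective eq)) k h

  lookup-≡⇒init-≡ : ∀ {m} {xs ys : Vec A (suc m)} →
                    (∀ k → suc (toℕ k) <ℕ suc m → lookup xs k ≡ lookup ys k) → init xs ≡ init ys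
  lookup-≡⇒init-≡ {zero}  {_ ∷ []} {_ ∷ []} _  = refl
  lookup-≡⇒init-≡ {suc m} {_ ∷ _}  {_ ∷ _}  eq =
    cong₂ _∷_ (eq 0F (s≤s (s≤s z≤n))) (lookup-≡⇒init-≡ (λ k h → eq (Fin.suc k) (s≤s h)))

module CopyCover
  {V Copy : Set} (_≟_ : DecidableEquality Copy)
  (_∈_ : V → Copy → Set) (_~_ : V → V → Set)
  (edge-in-copy : ∀ {x y} → x ~ y → ∃ λ c → x ∈ c × y ∈ c)
  (at-most-two-copies : ∀ {x P Q R} → x ∈ P → x ∈ Q → x ∈ R → P ≡ Q ⊎ Q ≡ R ⊎ P ≡ R)
  (separated : ∀ {x y P Q} → P ≢ Q → x ∈ P → x ∈ Q → y ∈ P → y ∈ Q → ¬ x ~ y)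
  where

  neighbour-in-either : ∀ {x y P Q} → P ≢ Q → x ∈ P → x ∈ Q → x ~ y → y ∈ P ⊎ y ∈ Q
  neighbour-in-either P≢Q x∈P x∈Q x~y with edge-in-copy x~y
  ... | R , x∈R , y∈R with at-most-two-copies x∈P x∈Q x∈R
  ...   | inj₁ P≡Q         = ⊥-elim (P≢Q P≡Q)
  ...   | inj₂ (inj₁ refl) = inj₂ y∈R
  ...   | inj₂ (inj₂ refl) = inj₁ y∈R

  triangle-in-copy : ∀ {x₁ x₂ x₃ x₄} → x₁ ~ x₂ → x₁ ~ x₃ → x₂ ~ x₃ → x₁ ~ x₄ → x₂ ~ x₄ → x₃ ~ x₄ →
                     ∃ λ c → x₁ ∈ c × x₂ ∈ c × x₃ ∈ c
  triangle-in-copy {x₄ = x₄} a₁₂ a₁₃ a₂₃ a₁₄ a₂₄ a₃₄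
    with edge-in-copy a₁₂ | edge-in-copy a₁₃ | edge-in-copy a₂₃
  ... | A , x₁∈A , x₂∈A | B , x₁∈B , x₃∈B | C , x₂∈C , x₃∈C with A ≟ B | A ≟ C | B ≟ C
  ...   | yes refl | _        | _        = A , x₁∈A , x₂∈A , x₃∈B
  ...   | no _     | yes refl | _        = A , x₁∈A , x₂∈A , x₃∈C
  ...   | no _     | no _     | yes refl = B , x₁∈B , x₂∈C , x₃∈B
  ...   | no A≢B   | no A≢C   | no B≢C   =
    ⊥-elim (x₄-in-no-two (neighbour-in-either A≢B x₁∈A x₁∈B a₁₄)
                         (neighbour-in-either A≢C x₂∈A x₂∈C a₂₄)
                         (neighbour-in-either B≢C x₃∈B x₃∈C a₃₄))
    where
    x₄-in-no-two : x₄ ∈ A ⊎ x₄ ∈ B → x₄ ∈ A ⊎ x₄ ∈ C → x₄ ∈ B ⊎ x₄ ∈ C → ⊥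
    x₄-in-no-two (inj₁ x₄∈A) _           (inj₁ x₄∈B) = separated A≢B x₁∈A x₁∈B x₄∈A x₄∈B a₁₄
    x₄-in-no-two (inj₁ x₄∈A) _           (inj₂ x₄∈C) = separated A≢C x₂∈A x₂∈C x₄∈A x₄∈C a₂₄
    x₄-in-no-two (inj₂ x₄∈B) (inj₁ x₄∈A) _           = separated A≢B x₁∈A x₁∈B x₄∈A x₄∈B a₁₄
    x₄-in-no-two (inj₂ x₄∈B) (inj₂ x₄∈C) _           = separated B≢C x₃∈B x₃∈C x₄∈B x₄∈C a₃₄

  common-neighbour-in-copy : ∀ {x₁ x₂ x₃ y c} → x₁ ∈ c → x₂ ∈ c → x₃ ∈ c →
                             x₁ ~ x₂ → x₁ ~ x₃ → x₂ ~ x₃ → x₁ ~ y → x₂ ~ y → x₃ ~ y → y ∈ c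
  common-neighbour-in-copy {c = c} x₁∈c x₂∈c x₃∈c a₁₂ a₁₃ a₂₃ a₁ a₂ a₃
    with edge-in-copy a₁ | edge-in-copy a₂ | edge-in-copy a₃
  ... | Q₁ , x₁∈Q₁ , y∈Q₁ | Q₂ , x₂∈Q₂ , y∈Q₂ | Q₃ , x₃∈Q₃ , y∈Q₃ with Q₁ ≟ c | Q₂ ≟ c | Q₃ ≟ c
  ...   | yes refl | _        | _        = y∈Q₁
  ...   | no _     | yes refl | _        = y∈Q₂
  ...   | no _     | no _     | yes refl = y∈Q₃
  ...   | no Q₁≢c  | no Q₂≢c  | no _     with at-most-two-copies y∈Q₁ y∈Q₂ y∈Q₃
  ...     | inj₁ refl        = ⊥-elim (separated (≢-sym Q₁≢c) x₁∈c x₁∈Q₁ x₂∈c x₂∈Q₂ a₁₂)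
  ...     | inj₂ (inj₁ refl) = ⊥-elim (separated (≢-sym Q₂≢c) x₂∈c x₂∈Q₂ x₃∈c x₃∈Q₃ a₂₃)
  ...     | inj₂ (inj₂ refl) = ⊥-elim (separated (≢-sym Q₁≢c) x₁∈c x₁∈Q₁ x₃∈c x₃∈Q₃ a₁₃)

module Sierpinski {n : ℕ} (G : SimpleGraph n) (s : ℕ) where

  W : Set
  W = Word n (suc s)

  _≈_ : Rel W _
  _≈_ = _≈S_ G

  NonLast : Fin (suc s) → Set
  NonLast i = suc (toℕ i) <ℕ suc s

  successor : ∀ i → NonLast i → Fin (suc s)
  successor i h = fromℕ< h

  <-successor : ∀ i (h : NonLast i) → i < successor i h
  <-successor i h = subst (toℕ i <ℕ_) (≡.sym (toℕ-fromℕ< h)) ℕ.≤-refl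

  nonLast<last : ∀ {k i} → NonLast k → ¬ NonLast i → k < i
  nonLast<last hk hi = ℕ.≤-trans (s≤s⁻¹ hk) (s≤s⁻¹ (ℕ.≮⇒≥ hi))

  Linking-sym : ∀ {a b : W} → Linking G a b → Linking G b a
  Linking-sym (i , h , before , a≢b , adj , after) =
    i , h , (λ j j<i → ≡.sym (before j j<i)) , ≢-sym a≢b , SimpleGraph.sym G adj ,
    (λ j i<j → proj₂ (after j i<j) , proj₁ (after j i<j))

  -- After an edge at position i the word y is constant, while an edge at a
  -- non-last position j forces y to change between positions j and j + 1.
  EdgeAt⇒¬EdgeAt-later : ∀ {i j} {x y z : W} → i < j → NonLast j →
                         EdgeAt G i y x → ¬ EdgeAt G j y z
  EdgeAt⇒¬EdgeAt-later {i} {j} {x} {y} {z} i<j hj (_ , _ , _ , after₁) (_ , y≢z , _ , after₂) =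
    y≢z (begin
      lookup y j   ≡⟨ proj₁ (after₁ j i<j) ⟩
      lookup x i   ≡⟨ ≡.sym (proj₁ (after₁ j′ (<-trans i<j j<j′))) ⟩
      lookup y j′  ≡⟨ proj₁ (after₂ j′ j<j′) ⟩
      lookup z j   ∎)
    where
    open ≡-Reasoning
    j′ : Fin (suc s)
    j′ = successor j hj
    j<j′ : j < j′
    j<j′ = <-successor j hj

  EdgeAt-functional : ∀ {i} {x y z : W} → NonLast i → EdgeAt G i y x → EdgeAt G i y z → x ≡ z
  EdgeAt-functional {i} {x} {y} {z} hi (before₁ , _ , _ , after₁) (before₂ , _ , _ , after₂) =
    lookup-ext pointwise
    where
    i′ : Fin (suc s)
    i′ = successor i hi
    i<i′ : i < i′
    i<i′ = <-successor i hi
    pointwise : ∀ k → lookup x k ≡ lookup z k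
    pointwise k with <-cmp k i
    ... | tri< k<i _ _ = trans (≡.sym (before₁ k k<i)) (before₂ k k<i)
    ... | tri≈ _ refl _ = trans (≡.sym (proj₁ (after₁ i′ i<i′))) (proj₁ (after₂ i′ i<i′))
    ... | tri> _ _ i<k = trans (proj₂ (after₁ k i<k)) (≡.sym (proj₂ (after₂ k i<k)))

  -- EdgeAt and Linking unfold to Σ-types, so their word arguments cannot be
  -- inferred by unification and are passed explicitly.
  Linking-functional : ∀ {x y z : W} → Linking G y x → Linking G y z → x ≡ z
  Linking-functional {x} {y} {z} (i , hi , e₁) (j , hj , e₂) with <-cmp i j
  ... | tri< i<j _ _ = ⊥-elim (EdgeAt⇒¬EdgeAt-later {x = x} {y} {z} i<j hj e₁ e₂)
  ... | tri> _ _ j<i = ⊥-elim (EdgeAt⇒¬EdgeAt-later {x = z} {y} {x} j<i hi e₂ e₁)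
  ... | tri≈ _ refl _ = EdgeAt-functional {x = x} {y} {z} hi e₁ e₂

  Linking-trans⇒≡ : ∀ {x y z : W} → Linking G x y → Linking G y z → x ≡ z
  Linking-trans⇒≡ {x} {y} {z} xy yz = Linking-functional {x} {y} {z} (Linking-sym {x} {y} xy) yz

  SameOrLinked : Rel W _
  SameOrLinked x y = x ≡ y ⊎ Linking G x y

  SameOrLinked-isEquivalence : IsEquivalence SameOrLinked
  SameOrLinked-isEquivalence = record { refl = inj₁ refl ; sym = sym′ ; trans = trans′ }
    where
    sym′ : ∀ {x y} → SameOrLinked x y → SameOrLinked y x
    sym′ (inj₁ refl)     = inj₁ refl
    sym′ {x} {y} (inj₂ l) = inj₂ (Linking-sym {x} {y} l)
    trans′ : ∀ {x y z} → SameOrLinked x y → SameOrLinked y z → SameOrLinked x z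
    trans′ (inj₁ refl) q                = q
    trans′ (inj₂ l) (inj₁ refl)         = inj₂ l
    trans′ {x} {y} {z} (inj₂ l) (inj₂ l′) = inj₁ (Linking-trans⇒≡ {x} {y} {z} l l′)

  ≈⇒SameOrLinked : ∀ {x y} → x ≈ y → SameOrLinked x y
  ≈⇒SameOrLinked = EqClosure.fold SameOrLinked-isEquivalence inj₂

  ¬Linking-earlier : ∀ {i j} {a b c d : W} → i < j → NonLast i →
                     EdgeAt G i a b → EdgeAt G j c d → init a ≡ init c → init b ≡ init d → ⊥
  ¬Linking-earlier {i} {j} {a} {b} {c} {d} i<j hi (_ , a≢b , _) (before , _) ac bd =
    a≢b (begin
      lookup a i  ≡⟨ init-≡⇒lookup-≡ ac i hi ⟩
      lookup c i  ≡⟨ before i i<j ⟩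
      lookup d i  ≡⟨ ≡.sym (init-≡⇒lookup-≡ bd i hi) ⟩
      lookup b i  ∎)
    where open ≡-Reasoning

  Linking-between-copies-unique : ∀ {a b c d : W} → Linking G a b → Linking G c d →
                                  init a ≡ init c → init b ≡ init d → a ≡ c
  Linking-between-copies-unique (i , hi , e₁) (j , hj , e₂) ac bd with <-cmp i j
  ... | tri< i<j _ _ = ⊥-elim (¬Linking-earlier i<j hi e₁ e₂ ac bd)
  ... | tri> _ _ j<i = ⊥-elim (¬Linking-earlier j<i hj e₂ e₁ (≡.sym ac) (≡.sym bd))
  Linking-between-copies-unique {a} {b} {c} {d}
    (i , hi , (_ , _ , _ , after₁)) (.i , _ , (_ , _ , _ , after₂)) ac bd | tri≈ _ refl _ =
    lookup-ext pointwise
    where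
    pointwise : ∀ k → lookup a k ≡ lookup c k
    pointwise k with <-cmp k i
    ... | tri< k<i _ _ = init-≡⇒lookup-≡ ac k (ℕ.<-trans (s≤s k<i) hi)
    ... | tri≈ _ refl _ = init-≡⇒lookup-≡ ac k hi
    ... | tri> _ _ i<k =
      trans (proj₁ (after₁ k i<k)) (trans (init-≡⇒lookup-≡ bd i hi) (≡.sym (proj₁ (after₂ k i<k))))

  Prefix : Set
  Prefix = Vec (Fin n) s

  -- The image of the word x in S[G,t] is a vertex of the copy G_w.
  _∈Copy_ : W → Prefix → Set
  x ∈Copy w = ∃ λ v → x ≈ (w ∷ʳ v)

  ≈⇒∈Copy-init : ∀ {x a} → x ≈ a → x ∈Copy init a
  ≈⇒∈Copy-init {x} {a} x≈a = last a , subst (x ≈_) (proj₂ (proj₂ (initLast a))) x≈a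

  GAdj⇒common-copy : ∀ {x y} → GAdj G x y → ∃ λ w → x ∈Copy w × y ∈Copy w
  GAdj⇒common-copy {x} {y} (x≉y , u , v , x≈u , y≈v , i , e@(before , _))
    with suc (toℕ i) ℕ.<? suc s
  ... | yes hi = ⊥-elim (x≉y (x≈u ◅◅ EqClosure.return (i , hi , e) ◅◅ EqClosure.symmetric _ y≈v))
  ... | no hi  = init u , ≈⇒∈Copy-init x≈u , subst (y ∈Copy_) (≡.sym same-prefix) (≈⇒∈Copy-init y≈v)
    where
    same-prefix : init u ≡ init v
    same-prefix = lookup-≡⇒init-≡ (λ k hk → before k (nonLast<last hk hi))

  at-most-two-copies : ∀ {x P Q R} → x ∈Copy P → x ∈Copy Q → x ∈Copy R → P ≡ Q ⊎ Q ≡ R ⊎ P ≡ R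
  at-most-two-copies {P = P} {Q} {R} (u , x≈a) (v , x≈b) (w , x≈c)
    with ≈⇒SameOrLinked (EqClosure.symmetric _ x≈a ◅◅ x≈b)
       | ≈⇒SameOrLinked (EqClosure.symmetric _ x≈b ◅◅ x≈c)
  ... | inj₁ a≡b | _        = inj₁ (∷ʳ-injectiveˡ P Q a≡b)
  ... | inj₂ _   | inj₁ b≡c = inj₂ (inj₁ (∷ʳ-injectiveˡ Q R b≡c))
  ... | inj₂ ab  | inj₂ bc  = inj₂ (inj₂ (∷ʳ-injectiveˡ P R (Linking-trans⇒≡ {P ∷ʳ u} {Q ∷ʳ v} ab bc)))

  two-common-copies⇒≈ : ∀ {x y P Q} → P ≢ Q →
                        x ∈Copy P → x ∈Copy Q → y ∈Copy P → y ∈Copy Q → x ≈ y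
  two-common-copies⇒≈ {x} {y} {P} {Q} P≢Q (u , x≈a) (u′ , x≈b) (v , y≈c) (v′ , y≈d)
    with ≈⇒SameOrLinked (EqClosure.symmetric _ x≈a ◅◅ x≈b)
       | ≈⇒SameOrLinked (EqClosure.symmetric _ y≈c ◅◅ y≈d)
  ... | inj₁ a≡b | _        = ⊥-elim (P≢Q (∷ʳ-injectiveˡ P Q a≡b))
  ... | inj₂ _   | inj₁ c≡d = ⊥-elim (P≢Q (∷ʳ-injectiveˡ P Q c≡d))
  ... | inj₂ ab  | inj₂ cd  =
    subst (x ≈_) a≡c x≈a ◅◅ EqClosure.symmetric _ y≈c
    where
    a≡c : P ∷ʳ u ≡ P ∷ʳ v
    a≡c = Linking-between-copies-unique ab cd
            (trans (init-∷ʳ u P) (≡.sym (init-∷ʳ v P)))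
            (trans (init-∷ʳ u′ Q) (≡.sym (init-∷ʳ v′ Q)))

  open CopyCover (Vec.≡-dec Fin._≟_) _∈Copy_ (GAdj G) GAdj⇒common-copy at-most-two-copies
    (λ P≢Q x∈P x∈Q y∈P y∈Q x~y → proj₁ x~y (two-common-copies⇒≈ P≢Q x∈P x∈Q y∈P y∈Q))
    public

mainTheorem14 : (n : ℕ) → 2 ≤ n → (G : SimpleGraph n) → (s : ℕ) → 2 ≤ suc s →
    (C : List (Word n (suc s))) → IsClique G C → 4 ≤ length C →
    ∃ λ (w : Vec (Fin n) s) → All (λ x → ∃ λ (v : Fin n) → _≈S_ G x (w ∷ʳ v)) C
mainTheorem14 n _ G s _ (x₁ ∷ x₂ ∷ x₃ ∷ ys@(_ ∷ _)) clique (s≤s (s≤s (s≤s (s≤s _)))) =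
  let w , x₁∈w , x₂∈w , x₃∈w = triangle-in-copy a₁₂ a₁₃ a₂₃ (a₁ 0F) (a₂ 0F) (a₃ 0F)
  in  w , x₁∈w ∷ x₂∈w ∷ x₃∈w ∷ subst (All (_∈Copy w)) (tabulate-lookup ys)
        (tabulate⁺ λ k → common-neighbour-in-copy x₁∈w x₂∈w x₃∈w a₁₂ a₁₃ a₂₃ (a₁ k) (a₂ k) (a₃ k))
  where
  open Sierpinski G s
  a₁₂ : GAdj G x₁ x₂
  a₁₂ = clique 0F 1F λ ()
  a₁₃ : GAdj G x₁ x₃
  a₁₃ = clique 0F 2F λ ()
  a₂₃ : GAdj G x₂ x₃
  a₂₃ = clique 1F 2F λ ()
  a₁ : ∀ k → GAdj G x₁ (List.lookup ys k)
  a₁ k = clique 0F (3 ↑ʳ k) λ ()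
  a₂ : ∀ k → GAdj G x₂ (List.lookup ys k)
  a₂ k = clique 1F (3 ↑ʳ k) λ ()
  a₃ : ∀ k → GAdj G x₃ (List.lookup ys k)
  a₃ k = clique 2F (3 ↑ʳ k) λ ()
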